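{- There is an absolute constant $c>0$ such that for every positive integer $k$, with $K=2^k$, $n=2^K$ and $\tilde X$ the sequence defined below (of length $m=(n/2+1)\,n\,K$), we have $\mathsf{Funnel}(\tilde X)\ge c\,m\lg\lg n$.
   Context: Bit-reversal: $\mathrm{bitReversal}^k\in\{0,\dots,K-1\}^K$ is the sequence whose $i$-th entry ($1\le i\le K$) is obtained by writing $i-1$ in binary with exactly $k$ digits (leading zeros), reversing the digit string, and reading it back as a number. For $0\le i\le n/2$ let $S_i=(i+2^{\mathrm{bitReversal}^k_1},\dots,i+2^{\mathrm{bitReversal}^k_K})$, and let $\tilde X$ be the concatenation of $n$ copies of $S_0$, followed by $n$ copies of $S_1$, ..., followed by $n$ copies of $S_{n/2}$. Geometric view: $G_X=\{(x_j,j):j\in[m]\}$ for $X=(x_1,\dots,x_m)$; for a point $p$, $p.x,p.y$ are its coordinates. Mixing value: for disjoint finite $L,R\subset\mathbb{R}$, $\mathrm{mix}(L,R)\in\{\mathtt{L},\mathtt{R}\}^*$ lists $L\cup R$ in increasing order writing $\mathtt{L}$ for elements of $L$ and $\mathtt{R}$ for those of $R$; $\mathrm{blocks}(s)$ is $0$ for the empty word, else the number of maximal runs of equal letters; $\mathrm{mixValue}(L,R)=\mathrm{blocks}(\mathrm{mix}(L,R))$. Funnel bound: $\mathrm{rect}(p,q)$ is the smallest closed axis-aligned rectangle containing $p,q$. For $P$ finite and $p\in P$: $F_L(P,p)=\{q\in P: q.y<p.y,\ q.x<p.x,\ P\cap\mathrm{rect}(p,q)=\{p,q\}\}$, $F_R(P,p)$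 the same with $q.x>p.x$; $f(P,p)=\mathrm{mixValue}(F_L(P,p).y,F_R(P,p).y)$ with $S.y=\{q.y:q\in S\}$; $\mathsf{Funnel}(P)=\sum_{p\in P}f(P,p)$ and $\mathsf{Funnel}(X)=\mathsf{Funnel}(G_X)$. $\lg=\log_2$. -}

module Defs where

open import Data.Bool using (Bool; true; false; _∧_; _∨_; not; if_then_else_)
open import Data.Nat using (ℕ; zero; suc; _+_; _*_; _∸_; _^_; _≡ᵇ_; _<ᵇ_; _≤ᵇ_)
open import Data.Nat.DivMod using (_/_; _%_)
open import Data.Nat.Properties using (≤-decTotalOrder)
open import Data.Nat.Logarithm using (⌊log₂_⌋)
open import Data.List using (List; []; _∷_; map; concat; replicate; upTo; reverse; foldl; filterᵇ; length; zip; _++_)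
open import Data.Bool.ListAction using (any; all)
open import Data.Nat.ListAction using (sum)
open import Data.Product using (_×_; _,_; proj₁; proj₂)
import Data.List.Sort.InsertionSort.Base as ISort

binary : ℕ → ℕ → List ℕ
binary zero    n = []
binary (suc k) n = binary k (n / 2) ++ (n % 2 ∷ [])

readBinary : List ℕ → ℕ
readBinary = foldl (λ acc b → 2 * acc + b) 0

-- bitReversal^k as a list of length K = 2^k; its i-th entry (1 ≤ i ≤ K)
-- is the reversal of the k-digit binary string of i-1
bitReversal : ℕ → List ℕ
bitReversal k = map (λ i → readBinary (reverse (binary k i))) (upTo (2 ^ k))

S : ℕ → ℕ → List ℕ
S k i = map (λ b → i + 2 ^ b) (bitReversal k)

Xtilde : ℕ → List ℕ
Xtilde k = concat (map (λ i → concat (replicate n (S k i))) (upTo (n / 2 + 1)))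
  where n = 2 ^ (2 ^ k)

Point : Set
Point = ℕ × ℕ

px py : Point → ℕ
px = proj₁
py = proj₂

-- G_X = {(x_j , j) : j ∈ [m]} with [m] = {1, ..., m}
geom : List ℕ → List Point
geom X = zip X (map suc (upTo (length X)))

data Side : Set where
  Lt Rt : Side

_==ˢ_ : Side → Side → Bool
Lt ==ˢ Lt = true
Rt ==ˢ Rt = true
_  ==ˢ _  = false

open ISort ≤-decTotalOrder using (sort)

_∈ᵇ_ : ℕ → List ℕ → Bool
y ∈ᵇ L = any (λ z → y ≡ᵇ z) L

-- mix(L,R): the elements of L ∪ R in increasing order, each replaced by
-- its side label (L and R are finite sets of naturals given as lists)
mix : List ℕ → List ℕ → List Side
mix L R = map (λ y → if y ∈ᵇ L then Lt else Rt) (sort (L ++ R))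

blocks : List Side → ℕ
blocks []           = 0
blocks (x ∷ [])     = 1
blocks (x ∷ y ∷ s)  = (if x ==ˢ y then 0 else 1) + blocks (y ∷ s)

mixValue : List ℕ → List ℕ → ℕ
mixValue L R = blocks (mix L R)

_==ᵖ_ : Point → Point → Bool
p ==ᵖ q = (px p ≡ᵇ px q) ∧ (py p ≡ᵇ py q)

min max : ℕ → ℕ → ℕ
min a b = if a ≤ᵇ b then a else b
max a b = if a ≤ᵇ b then b else a

inRect : Point → Point → Point → Bool
inRect p q r =
  (min (px p) (px q) ≤ᵇ px r) ∧ (px r ≤ᵇ max (px p) (px q)) ∧
  (min (py p) (py q) ≤ᵇ py r) ∧ (py r ≤ᵇ max (py p) (py q))

emptyRect : List Point → Point → Point → Bool
emptyRect P p q = all (λ r → not (inRect p q r) ∨ (r ==ᵖ p) ∨ (r ==ᵖ q)) P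

FL FR : List Point → Point → List Point
FL P p = filterᵇ (λ q → (py q <ᵇ py p) ∧ (px q <ᵇ px p) ∧ emptyRect P p q) P
FR P p = filterᵇ (λ q → (py q <ᵇ py p) ∧ (px p <ᵇ px q) ∧ emptyRect P p q) P

ys : List Point → List ℕ
ys = map py

f : List Point → Point → ℕ
f P p = mixValue (ys (FL P p)) (ys (FR P p))

FunnelP : List Point → ℕ
FunnelP P = sum (map (f P) P)

Funnel : List ℕ → ℕ
Funnel X = FunnelP (geom X)

lg : ℕ → ℕ
lg n = ⌊log₂ n ⌋

open import Data.Integer using (+_)
import Data.Rational as ℚ
toℚ : ℕ → ℚ.ℚ
toℚ n = (+ n) ℚ./ 1

module Submission where

-- View X̃ as the function xtilde k t = ⌊t / nK⌋ + 2^(reversal k t) of its position t < m, where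
-- reversal k t reads the k lowest binary digits of t backwards. Take a position t whose 2^k - 1
-- predecessors lie in the same block of n copies of S_i (every position outside the first copy
-- of each block). For each digit a < k, the earlier point at distance 2^a spans an empty
-- rectangle with t: the positions strictly between differ from t below digit a, which puts their
-- reversals on the same side of both. It is a left or a right funnel point of t according to
-- digit a of t, and these k witnesses occur in mix(F_L, F_R) ordered by digit, so the funnel
-- value of t is at least the number of runs of equal digits among the k lowest digits of t.
-- Summing over a period, Σ_{j<2^k} runs k j = (k+1) 2^(k-1); hence
-- Funnel(X̃) ≥ (n/2+1)(n-1)(k+1) 2^(k-1) ≥ ¼ m k, and k = lg lg n.

open import Defs
open import Data.Nat using (ℕ; _≥_; _^_; _+_; _*_)
open import Data.Nat.DivMod using (_/_)
open import Data.Product using (Σ; _×_)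
open import Data.Rational using (ℚ; 0ℚ) renaming (_<_ to _<ℚ_; _≤_ to _≤ℚ_; _*_ to _*ℚ_)

open import Data.Nat using (zero; suc; _∸_; _≤_; _<_; z≤n; s≤s; _≟_; _≡ᵇ_; _<ᵇ_; _≤ᵇ_; NonZero)
open import Data.Nat.Properties
open import Data.Nat.DivMod using (_%_; m%n<n; [m+kn]%n≡m%n; m*n/n≡m; +-distrib-/-∣ʳ; m<n⇒m/n≡0; m<n*o⇒m/o<n)
open import Data.Nat.Divisibility using (divides)
open import Data.Product using (_,_; proj₁; proj₂)
open import Data.Sum using (_⊎_; inj₁; inj₂)
open import Data.Unit using (⊤; tt)
open import Data.Bool using (true; false; T; not; _∧_; _∨_; if_then_else_)
open import Data.List.Relation.Unary.All as All using (All; []; _∷_)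
open import Data.List.Relation.Unary.Any as Any using (here; there)
open import Data.List.Relation.Unary.AllPairs using (AllPairs; []; _∷_)
import Data.List.Relation.Unary.AllPairs.Properties as AllPairs
import Data.List.Relation.Unary.All.Properties as All
open import Data.List.Relation.Unary.Linked.Properties using (Linked⇒AllPairs)
open import Data.List.Relation.Binary.Sublist.Propositional using (_⊆_; []; _∷ʳ_; _∷_)
open import Data.List.Relation.Binary.Sublist.Propositional.Properties using () renaming (map⁺ to ⊆-map⁺)
open import Data.List.Relation.Binary.Permutation.Propositional using (↭-sym)
open import Data.List.Relation.Binary.Permutation.Propositional.Properties using (∈-resp-↭)
open import Data.List.Membership.Propositional using (_∈_)
open import Data.List.Membership.Propositional.Properties using (∈-++⁺ˡ; ∈-++⁺ʳ; ∈-map⁺; ∈-map⁻; ∈-filter⁺; ∈-filter⁻; ∈-applyUpTo⁺; ∈-applyUpTo⁻)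
open import Data.List.Relation.Unary.Any.Properties using (any⁺; any⁻)
open import Data.List.Relation.Unary.All.Properties using (all⁻)
import Data.List.Sort.InsertionSort.Base as InsertionSort
import Data.List.Sort.InsertionSort.Properties as InsertionSortProperties
open import Data.Empty using (⊥; ⊥-elim)
open import Data.List using (List; []; _∷_; _++_; map; reverse; foldl; length; applyUpTo; applyDownFrom; concat; replicate; zip; upTo)
open import Data.List.Properties using (reverse-++; length-reverse; length-++; length-applyUpTo; map-applyUpTo; map-upTo; map-applyDownFrom; map-∘)
open import Data.Nat.ListAction using (sum)
open import Data.Nat.ListAction.Properties using (sum-++)
open import Function using (_∘_; _on_)
open import Relation.Nullary using (¬_; yes; no)
open import Relation.Binary.Definitions using (tri<; tri≈; tri>)
open import Relation.Binary.PropositionalEquality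
open import Data.Nat.Tactic.RingSolver using (solve-∀)
open import Data.Nat.Logarithm using (⌊log₂[2^n]⌋≡n)
open import Data.Nat.Coprimality using (1-coprimeTo) renaming (sym to coprime-sym)
import Data.Integer as ℤ
open import Data.Sign.Base using (Sign)
import Data.Integer.Properties as ℤ
import Data.Rational as ℚ
import Data.Rational.Properties as ℚ
import Data.Rational.Unnormalised as ℚᵘ
import Data.Rational.Unnormalised.Properties as ℚᵘ

bit : ℕ → ℕ → ℕ
bit zero    x = x % 2
bit (suc a) x = bit a (x / 2)

AgreeBelow : ℕ → ℕ → ℕ → Set
AgreeBelow zero    x y = ⊤
AgreeBelow (suc a) x y = x % 2 ≡ y % 2 × AgreeBelow a (x / 2) (y / 2)

reversal : ℕ → ℕ → ℕ
reversal zero    x = 0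
reversal (suc k) x = x % 2 * 2 ^ k + reversal k (x / 2)

2^suc : ∀ a → 2 ^ suc a ≡ 2 ^ a * 2
2^suc a = *-comm 2 (2 ^ a)

%2≤1 : ∀ x → x % 2 ≤ 1
%2≤1 x = ≤-pred (m%n<n x 2)

suc-%2 : ∀ s → suc s % 2 ≢ s % 2
suc-%2 zero ()
suc-%2 (suc zero) ()
suc-%2 (suc (suc s)) = suc-%2 s

bit-01 : ∀ a x → bit a x ≡ 0 ⊎ bit a x ≡ 1
bit-01 zero x with x % 2 | %2≤1 x
... | zero     | _ = inj₁ refl
... | suc zero | _ = inj₂ refl
... | suc (suc _) | s≤s ()
bit-01 (suc a) x = bit-01 a (x / 2)

bit≢1 : ∀ a x → bit a x ≢ 1 → bit a x ≡ 0
bit≢1 a x ≢1 with bit-01 a x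
... | inj₁ e = e
... | inj₂ e = ⊥-elim (≢1 e)

bit≢0 : ∀ a x → bit a x ≢ 0 → bit a x ≡ 1
bit≢0 a x ≢0 with bit-01 a x
... | inj₂ e = e
... | inj₁ e = ⊥-elim (≢0 e)

[s+m*2]%2 : ∀ s m → (s + m * 2) % 2 ≡ s % 2
[s+m*2]%2 s m = [m+kn]%n≡m%n s m 2

[s+m*2]/2 : ∀ s m → (s + m * 2) / 2 ≡ s / 2 + m
[s+m*2]/2 s m = trans (+-distrib-/-∣ʳ s (divides m refl)) (cong (s / 2 +_) (m*n/n≡m m 2))

half< : ∀ k u → u < 2 ^ suc k → u / 2 < 2 ^ k
half< k u u< = m<n*o⇒m/o<n (subst (u <_) (2^suc k) u<)

agree-sym : ∀ a {x y} → AgreeBelow a x y → AgreeBelow a y x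
agree-sym zero    _       = tt
agree-sym (suc a) (e , g) = sym e , agree-sym a g

agree-trans : ∀ a {x y z} → AgreeBelow a x y → AgreeBelow a y z → AgreeBelow a x z
agree-trans zero    _       _         = tt
agree-trans (suc a) (e , g) (e′ , g′) = trans e e′ , agree-trans a g g′

agree-mono : ∀ {d a x y} → d ≤ a → AgreeBelow a x y → AgreeBelow d x y
agree-mono {zero}              _         _       = tt
agree-mono {suc d} {suc a} (s≤s d≤a) (e , g) = e , agree-mono d≤a g

agree⇒bit : ∀ {d a x y} → d < a → AgreeBelow a x y → bit d x ≡ bit d y
agree⇒bit {zero}  {suc a} _         (e , _) = e
agree⇒bit {suc d} {suc a} (s≤s d<a) (_ , g) = agree⇒bit d<a g

agree-+2^ : ∀ a s → AgreeBelow a (s + 2 ^ a) s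
agree-+2^ zero    s = tt
agree-+2^ (suc a) s rewrite 2^suc a =
  [s+m*2]%2 s (2 ^ a) , subst (λ z → AgreeBelow a z (s / 2)) (sym ([s+m*2]/2 s (2 ^ a))) (agree-+2^ a (s / 2))

bit-+2^ : ∀ a s → bit a (s + 2 ^ a) ≢ bit a s
bit-+2^ zero    s e = suc-%2 s (trans (cong (_% 2) (+-comm 1 s)) e)
bit-+2^ (suc a) s rewrite 2^suc a | [s+m*2]/2 s (2 ^ a) = bit-+2^ a (s / 2)

parity : ∀ d → Σ ℕ (λ e → d ≡ e * 2 ⊎ d ≡ suc (e * 2))
parity zero = 0 , inj₁ refl
parity (suc d) with parity d
... | e , inj₁ eq = e , inj₂ (cong suc eq)
... | e , inj₂ eq = suc e , inj₁ (cong suc eq)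

¬agree-+ : ∀ a s d → 0 < d → d < 2 ^ a → ¬ AgreeBelow a (s + d) s
¬agree-+ zero s d 0<d d<1 _ = <-irrefl refl (≤-trans 0<d (≤-pred d<1))
¬agree-+ (suc a) s d 0<d d<2^a (e , g) with parity d
... | h , inj₂ refl = suc-%2 s (trans (trans (sym ([s+m*2]%2 (suc s) h)) (cong (_% 2) (sym (+-suc s (h * 2))))) e)
... | h , inj₁ refl = ¬agree-+ a (s / 2) h 0<h h<2^a (subst (λ z → AgreeBelow a z (s / 2)) ([s+m*2]/2 s h) g)
  where
  0<h : 0 < h
  0<h = n≢0⇒n>0 (λ { refl → <-irrefl refl 0<d })
  h<2^a : h < 2 ^ a
  h<2^a = *-cancelʳ-< 2 h (2 ^ a) (subst (h * 2 <_) (2^suc a) d<2^a)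

firstDifference : ∀ a x y → ¬ AgreeBelow a x y → Σ ℕ (λ D → D < a × AgreeBelow D x y × bit D x ≢ bit D y)
firstDifference zero    x y ¬ag = ⊥-elim (¬ag tt)
firstDifference (suc a) x y ¬ag with x % 2 ≟ y % 2
... | no ne = 0 , s≤s z≤n , tt , ne
... | yes e with firstDifference a (x / 2) (y / 2) (λ g → ¬ag (e , g))
...   | D , D<a , g , ne = suc D , s≤s D<a , (e , g) , ne

reversal< : ∀ k x → reversal k x < 2 ^ k
reversal< zero    x = s≤s z≤n
reversal< (suc k) x = begin-strict
    x % 2 * 2 ^ k + reversal k (x / 2)  <⟨ +-monoʳ-< (x % 2 * 2 ^ k) (reversal< k (x / 2)) ⟩
    x % 2 * 2 ^ k + 2 ^ k               ≤⟨ +-monoˡ-≤ (2 ^ k) (*-monoˡ-≤ (2 ^ k) (%2≤1 x)) ⟩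
    1 * 2 ^ k + 2 ^ k                   ≡⟨ cong (_+ 2 ^ k) (*-identityˡ (2 ^ k)) ⟩
    2 ^ k + 2 ^ k                       ≡⟨ cong (2 ^ k +_) (sym (+-identityʳ (2 ^ k))) ⟩
    2 ^ suc k                           ∎
  where open ≤-Reasoning

reversal-< : ∀ k D x y → D < k → AgreeBelow D x y → bit D x ≡ 0 → bit D y ≡ 1 → reversal k x < reversal k y
reversal-< (suc k) zero x y _ _ bx by rewrite bx | by = begin-strict
    reversal k (x / 2)              <⟨ reversal< k (x / 2) ⟩
    2 ^ k                           ≤⟨ ≤-trans (m≤m+n (2 ^ k) 0) (m≤m+n (2 ^ k + 0) _) ⟩
    2 ^ k + 0 + reversal k (y / 2)  ∎
  where open ≤-Reasoning
reversal-< (suc k) (suc D) x y (s≤s D<k) (e , g) bx by rewrite e =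
  +-monoʳ-< (y % 2 * 2 ^ k) (reversal-< k D (x / 2) (y / 2) D<k g bx by)

-- if r differs from t below a while t and q agree below a, then reversal k r lies
-- strictly on the same side of reversal k t and reversal k q: the lowest digit D where r and t
-- differ is also the lowest digit where r and q differ, with the same digit values
reversal-sameSide : ∀ k a r t q → a < k → ¬ AgreeBelow a r t → AgreeBelow a t q →
  (reversal k r < reversal k t × reversal k r < reversal k q) ⊎ (reversal k t < reversal k r × reversal k q < reversal k r)
reversal-sameSide k a r t q a<k ¬ag ag with firstDifference a r t ¬ag
... | D , D<a , agreeRT , differRT = sides (bit-01 D r) (bit-01 D t)
  where
  D<k : D < k
  D<k = <-trans D<a a<k
  t≡q : bit D t ≡ bit D q
  t≡q = agree⇒bit D<a ag
  agreeRQ : AgreeBelow D r q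
  agreeRQ = agree-trans D agreeRT (agree-mono (<⇒≤ D<a) ag)
  sides : bit D r ≡ 0 ⊎ bit D r ≡ 1 → bit D t ≡ 0 ⊎ bit D t ≡ 1 →
    (reversal k r < reversal k t × reversal k r < reversal k q) ⊎ (reversal k t < reversal k r × reversal k q < reversal k r)
  sides (inj₁ r0) (inj₁ t0) = ⊥-elim (differRT (trans r0 (sym t0)))
  sides (inj₂ r1) (inj₂ t1) = ⊥-elim (differRT (trans r1 (sym t1)))
  sides (inj₁ r0) (inj₂ t1) = inj₁ (reversal-< k D r t D<k agreeRT r0 t1 ,
                                    reversal-< k D r q D<k agreeRQ r0 (trans (sym t≡q) t1))
  sides (inj₂ r1) (inj₁ t0) = inj₂ (reversal-< k D t r D<k (agree-sym D agreeRT) t0 r1 ,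
                                    reversal-< k D q r D<k (agree-sym D agreeRQ) (trans (sym t≡q) t0) r1)

c*2^suc : ∀ c k → c * 2 ^ suc k ≡ c * 2 ^ k * 2
c*2^suc c k = trans (cong (c *_) (2^suc k)) (sym (*-assoc c (2 ^ k) 2))

bit-+multiple : ∀ a k u c → a < k → bit a (u + c * 2 ^ k) ≡ bit a u
bit-+multiple zero    (suc k) u c _ rewrite c*2^suc c k = [s+m*2]%2 u (c * 2 ^ k)
bit-+multiple (suc a) (suc k) u c (s≤s a<k) rewrite c*2^suc c k | [s+m*2]/2 u (c * 2 ^ k) =
  bit-+multiple a k (u / 2) c a<k

reversal-+multiple : ∀ k u c → reversal k (u + c * 2 ^ k) ≡ reversal k u
reversal-+multiple zero    u c = refl
reversal-+multiple (suc k) u c rewrite c*2^suc c k | [s+m*2]/2 u (c * 2 ^ k) | [s+m*2]%2 u (c * 2 ^ k) =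
  cong (u % 2 * 2 ^ k +_) (reversal-+multiple k (u / 2) c)

bit-top0 : ∀ k u → u < 2 ^ k → bit k u ≡ 0
bit-top0 zero    zero    _        = refl
bit-top0 zero    (suc u) (s≤s ())
bit-top0 (suc k) u       u<      = bit-top0 k (u / 2) (half< k u u<)

bit-top1 : ∀ k u → u < 2 ^ k → bit k (u + 2 ^ k) ≡ 1
bit-top1 zero    zero    _        = refl
bit-top1 zero    (suc u) (s≤s ())
bit-top1 (suc k) u       u<      = begin
    bit k ((u + 2 ^ suc k) / 2)  ≡⟨ cong (λ z → bit k ((u + z) / 2)) (2^suc k) ⟩
    bit k ((u + 2 ^ k * 2) / 2)  ≡⟨ cong (bit k) ([s+m*2]/2 u (2 ^ k)) ⟩
    bit k (u / 2 + 2 ^ k)        ≡⟨ bit-top1 k (u / 2) (half< k u u<) ⟩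
    1                            ∎
  where open ≡-Reasoning

readBinary-acc : ∀ acc s → foldl (λ a b → 2 * a + b) acc s ≡ acc * 2 ^ length s + readBinary s
readBinary-acc acc [] = sym (trans (cong (_+ 0) (*-identityʳ acc)) (+-identityʳ acc))
readBinary-acc acc (b ∷ s) = begin
    foldl step (2 * acc + b) s                  ≡⟨ readBinary-acc (2 * acc + b) s ⟩
    (2 * acc + b) * P + readBinary s            ≡⟨ cong (_+ readBinary s) (*-distribʳ-+ P (2 * acc) b) ⟩
    (2 * acc * P + b * P) + readBinary s        ≡⟨ +-assoc (2 * acc * P) (b * P) (readBinary s) ⟩
    2 * acc * P + (b * P + readBinary s)        ≡⟨ cong₂ _+_ (trans (cong (_* P) (*-comm 2 acc)) (*-assoc acc 2 P))
                                                             (sym (readBinary-acc b s)) ⟩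
    acc * (2 * P) + foldl step b s              ∎
  where
  open ≡-Reasoning
  step : ℕ → ℕ → ℕ
  step a b = 2 * a + b
  P : ℕ
  P = 2 ^ length s

length-binary : ∀ k x → length (binary k x) ≡ k
length-binary zero    x = refl
length-binary (suc k) x =
  trans (length-++ (binary k (x / 2))) (trans (+-comm _ 1) (cong suc (length-binary k (x / 2))))

readBinary-reverse-binary : ∀ k x → readBinary (reverse (binary k x)) ≡ reversal k x
readBinary-reverse-binary zero    x = refl
readBinary-reverse-binary (suc k) x rewrite reverse-++ (binary k (x / 2)) (x % 2 ∷ []) =
  trans (readBinary-acc (x % 2) (reverse (binary k (x / 2))))
        (cong₂ _+_ (cong (λ z → x % 2 * 2 ^ z) (trans (length-reverse (binary k (x / 2))) (length-binary k (x / 2))))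
                   (readBinary-reverse-binary k (x / 2)))

applyUpTo-cong : ∀ {A : Set} {F G : ℕ → A} n → (∀ u → u < n → F u ≡ G u) → applyUpTo F n ≡ applyUpTo G n
applyUpTo-cong zero    _  = refl
applyUpTo-cong (suc n) F≡G = cong₂ _∷_ (F≡G 0 (s≤s z≤n)) (applyUpTo-cong n (λ u u<n → F≡G (suc u) (s≤s u<n)))

applyUpTo-++ : ∀ {A : Set} (F : ℕ → A) p q → applyUpTo F (p + q) ≡ applyUpTo F p ++ applyUpTo (λ u → F (p + u)) q
applyUpTo-++ F zero    q = refl
applyUpTo-++ F (suc p) q = cong (F 0 ∷_) (applyUpTo-++ (F ∘ suc) p q)

replicate-applyUpTo : ∀ {A : Set} n (x : A) → replicate n x ≡ applyUpTo (λ _ → x) n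
replicate-applyUpTo zero    x = refl
replicate-applyUpTo (suc n) x = cong (x ∷_) (replicate-applyUpTo n x)

zip-applyUpTo : ∀ {A B : Set} (F : ℕ → A) (G : ℕ → B) n → zip (applyUpTo F n) (applyUpTo G n) ≡ applyUpTo (λ u → F u , G u) n
zip-applyUpTo F G zero    = refl
zip-applyUpTo F G (suc n) = cong ((F 0 , G 0) ∷_) (zip-applyUpTo (F ∘ suc) (G ∘ suc) n)

concat-applyUpTo : ∀ {A : Set} (F : ℕ → A) L a →
  concat (applyUpTo (λ i → applyUpTo (λ j → F (i * L + j)) L) a) ≡ applyUpTo F (a * L)
concat-applyUpTo F L zero    = refl
concat-applyUpTo F L (suc a) = begin
    applyUpTo F L ++ concat (applyUpTo (λ i → applyUpTo (λ j → F (L + i * L + j)) L) a)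
  ≡⟨ cong (λ z → applyUpTo F L ++ concat z) (applyUpTo-cong a (λ i _ →
       applyUpTo-cong L (λ j _ → cong F (+-assoc L (i * L) j)))) ⟩
    applyUpTo F L ++ concat (applyUpTo (λ i → applyUpTo (λ j → F (L + (i * L + j))) L) a)
  ≡⟨ cong (applyUpTo F L ++_) (concat-applyUpTo (λ v → F (L + v)) L a) ⟩
    applyUpTo F L ++ applyUpTo (λ v → F (L + v)) (a * L)
  ≡⟨ sym (applyUpTo-++ F L (a * L)) ⟩
    applyUpTo F (L + a * L)
  ∎
  where open ≡-Reasoning

sumBelow : ℕ → (ℕ → ℕ) → ℕ
sumBelow n φ = sum (applyUpTo φ n)

sumBelow-split : ∀ p q φ → sumBelow (p + q) φ ≡ sumBelow p φ + sumBelow q (λ u → φ (p + u))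
sumBelow-split p q φ = trans (cong sum (applyUpTo-++ φ p q)) (sum-++ (applyUpTo φ p) _)

sumBelow-cong : ∀ n {ψ φ} → (∀ u → u < n → ψ u ≡ φ u) → sumBelow n ψ ≡ sumBelow n φ
sumBelow-cong n ψ≡φ = cong sum (applyUpTo-cong n ψ≡φ)

sumBelow-mono : ∀ n {ψ φ} → (∀ u → u < n → ψ u ≤ φ u) → sumBelow n ψ ≤ sumBelow n φ
sumBelow-mono zero    _   = z≤n
sumBelow-mono (suc n) ψ≤φ = +-mono-≤ (ψ≤φ 0 (s≤s z≤n)) (sumBelow-mono n (λ u u<n → ψ≤φ (suc u) (s≤s u<n)))

sumBelow-+ : ∀ n φ ψ → sumBelow n (λ u → φ u + ψ u) ≡ sumBelow n φ + sumBelow n ψ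
sumBelow-+ zero    φ ψ = refl
sumBelow-+ (suc n) φ ψ = trans (cong (φ 0 + ψ 0 +_) (sumBelow-+ n (φ ∘ suc) (ψ ∘ suc)))
                               (+-comm-middle (φ 0) (ψ 0) _ _)
  where
  +-comm-middle : ∀ w x y z → w + x + (y + z) ≡ w + y + (x + z)
  +-comm-middle = solve-∀

sumBelow-ones : ∀ n → sumBelow n (λ _ → 1) ≡ n
sumBelow-ones zero    = refl
sumBelow-ones (suc n) = cong suc (sumBelow-ones n)

sumBelow-blocks : ∀ a L C φ → (∀ i → i < a → C ≤ sumBelow L (λ j → φ (i * L + j))) → a * C ≤ sumBelow (a * L) φ
sumBelow-blocks zero    L C φ _     = z≤n
sumBelow-blocks (suc a) L C φ block = begin
    C + a * C
  ≤⟨ +-mono-≤ (block 0 (s≤s z≤n)) (sumBelow-blocks a L C (λ v → φ (L + v)) shifted) ⟩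
    sumBelow L φ + sumBelow (a * L) (λ v → φ (L + v))
  ≡⟨ sym (sumBelow-split L (a * L) φ) ⟩
    sumBelow (L + a * L) φ
  ∎
  where
  open ≤-Reasoning
  shifted : ∀ i → i < a → C ≤ sumBelow L (λ j → φ (L + (i * L + j)))
  shifted i i<a = subst (C ≤_) (sumBelow-cong L (λ j _ → cong φ (+-assoc L (i * L) j))) (block (suc i) (s≤s i<a))

side : ℕ → Side
side zero    = Rt
side (suc _) = Lt

digitWord : ℕ → ℕ → List Side
digitWord k t = applyDownFrom (λ a → side (bit a t)) k

runs : ℕ → ℕ → ℕ
runs k t = blocks (digitWord k t)

runs-cong : ∀ k t u → (∀ a → a < k → bit a t ≡ bit a u) → runs k t ≡ runs k u
runs-cong k t u same = cong blocks (digitWord-cong k (λ a a<k → same a a<k))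
  where
  digitWord-cong : ∀ j → (∀ a → a < j → bit a t ≡ bit a u) → digitWord j t ≡ digitWord j u
  digitWord-cong zero    _     = refl
  digitWord-cong (suc j) same′ = cong₂ _∷_ (cong side (same′ j ≤-refl)) (digitWord-cong j (λ a a<j → same′ a (m<n⇒m<1+n a<j)))

change : Side → Side → ℕ
change x y = if x ==ˢ y then 0 else 1

change-Rt+change-Lt : ∀ s → change Rt s + change Lt s ≡ 1
change-Rt+change-Lt Lt = refl
change-Rt+change-Lt Rt = refl

runs-top0 : ∀ k u → u < 2 ^ suc k → runs (suc (suc k)) u ≡ change Rt (side (bit k u)) + runs (suc k) u
runs-top0 k u u< = cong (λ d → change (side d) (side (bit k u)) + runs (suc k) u) (bit-top0 (suc k) u u<)

runs-top1 : ∀ k u → u < 2 ^ suc k → runs (suc (suc k)) (2 ^ suc k + u) ≡ change Lt (side (bit k u)) + runs (suc k) u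
runs-top1 k u u< = cong₂ _+_
    (cong₂ change (cong side (trans (cong (bit (suc k)) (+-comm M u)) (bit-top1 (suc k) u u<)))
                  (cong side (lowDigits k ≤-refl)))
    (runs-cong (suc k) (M + u) u (λ a → lowDigits a))
  where
  M : ℕ
  M = 2 ^ suc k
  lowDigits : ∀ a → a < suc k → bit a (M + u) ≡ bit a u
  lowDigits a a≤k = trans (cong (bit a) (trans (+-comm M u) (cong (u +_) (sym (*-identityˡ M)))))
                          (bit-+multiple a (suc k) u 1 a≤k)

-- doubling the range adds one run per u < 2^(k+1): exactly one of the two extensions of u
-- starts with a new run
sumBelow-runs-step : ∀ k → let M = 2 ^ suc k ; R = sumBelow M (runs (suc k)) in
  sumBelow (2 ^ suc (suc k)) (runs (suc (suc k))) ≡ M + (R + R)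
sumBelow-runs-step k = begin
    sumBelow (M + (M + 0)) ρ
  ≡⟨ trans (cong (λ z → sumBelow (M + z) ρ) (+-identityʳ M)) (sumBelow-split M M ρ) ⟩
    sumBelow M ρ + sumBelow M (λ u → ρ (M + u))
  ≡⟨ cong₂ _+_ (sumBelow-cong M (runs-top0 k)) (sumBelow-cong M (runs-top1 k)) ⟩
    sumBelow M (λ u → A u + r u) + sumBelow M (λ u → B u + r u)
  ≡⟨ cong₂ _+_ (sumBelow-+ M A r) (sumBelow-+ M B r) ⟩
    (sumBelow M A + R) + (sumBelow M B + R)
  ≡⟨ regroup (sumBelow M A) (sumBelow M B) R ⟩
    (sumBelow M A + sumBelow M B) + (R + R)
  ≡⟨ cong (_+ (R + R)) newRuns ⟩
    M + (R + R)
  ∎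
  where
  open ≡-Reasoning
  M R : ℕ
  M = 2 ^ suc k
  R = sumBelow M (runs (suc k))
  ρ r A B : ℕ → ℕ
  ρ = runs (suc (suc k))
  r = runs (suc k)
  A u = change Rt (side (bit k u))
  B u = change Lt (side (bit k u))
  newRuns : sumBelow M A + sumBelow M B ≡ M
  newRuns = trans (sym (sumBelow-+ M A B))
                  (trans (sumBelow-cong M (λ u _ → change-Rt+change-Lt (side (bit k u)))) (sumBelow-ones M))
  regroup : ∀ x y z → (x + z) + (y + z) ≡ (x + y) + (z + z)
  regroup = solve-∀

sumBelow-runs : ∀ k → sumBelow (2 ^ suc k) (runs (suc k)) ≡ (2 + k) * 2 ^ k
sumBelow-runs zero    = refl
sumBelow-runs (suc k) = begin
    sumBelow (2 ^ suc (suc k)) (runs (suc (suc k)))  ≡⟨ sumBelow-runs-step k ⟩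
    2 ^ suc k + (R + R)                              ≡⟨ cong (λ z → 2 ^ suc k + (z + z)) (sumBelow-runs k) ⟩
    2 * 2 ^ k + ((2 + k) * 2 ^ k + (2 + k) * 2 ^ k)  ≡⟨ total (2 ^ k) k ⟩
    (3 + k) * 2 ^ suc k                              ∎
  where
  open ≡-Reasoning
  R : ℕ
  R = sumBelow (2 ^ suc k) (runs (suc k))
  total : ∀ P k → 2 * P + ((2 + k) * P + (2 + k) * P) ≡ (3 + k) * (2 * P)
  total = solve-∀

∈⇒∈ᵇ : ∀ {y L} → y ∈ L → T (y ∈ᵇ L)
∈⇒∈ᵇ {y} y∈L = any⁺ (y ≡ᵇ_) (Any.map (≡⇒≡ᵇ y _) y∈L)

∈ᵇ⇒∈ : ∀ {y L} → T (y ∈ᵇ L) → y ∈ L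
∈ᵇ⇒∈ {y} {L} t = Any.map (≡ᵇ⇒≡ y _) (any⁻ (y ≡ᵇ_) L t)

T-∧-intro : ∀ {x y} → T x → T y → T (x ∧ y)
T-∧-intro {true} _ ty = ty

T-∧⇒ : ∀ x {y} → T (x ∧ y) → T x × T y
T-∧⇒ true ty = tt , ty

T-∨ˡ : ∀ x {y} → T x → T (x ∨ y)
T-∨ˡ true _ = tt

T-∨ʳ : ∀ x {y} → T y → T (x ∨ y)
T-∨ʳ true  _  = tt
T-∨ʳ false ty = ty

T-not : ∀ x → ¬ T x → T (not x)
T-not false _  = tt
T-not true  ¬t = ¬t tt

==ᵖ-refl : ∀ r → T (r ==ᵖ r)
==ᵖ-refl (x , y) = T-∧-intro (≡⇒≡ᵇ x x refl) (≡⇒≡ᵇ y y refl)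

change-triangle : ∀ x y z → change x z ≤ change x y + change y z
change-triangle Lt Lt Lt = z≤n
change-triangle Lt Lt Rt = ≤-refl
change-triangle Lt Rt Lt = z≤n
change-triangle Lt Rt Rt = ≤-refl
change-triangle Rt Lt Lt = ≤-refl
change-triangle Rt Lt Rt = z≤n
change-triangle Rt Rt Lt = ≤-refl
change-triangle Rt Rt Rt = z≤n

blocks-insert : ∀ x y v → blocks (x ∷ v) ≤ change x y + blocks (y ∷ v)
blocks-insert x y []      = m≤n+m 1 (change x y)
blocks-insert x y (z ∷ v) = begin
    change x z + blocks (z ∷ v)                 ≤⟨ +-monoˡ-≤ _ (change-triangle x y z) ⟩
    change x y + change y z + blocks (z ∷ v)    ≡⟨ +-assoc (change x y) _ _ ⟩
    change x y + (change y z + blocks (z ∷ v))  ∎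
  where open ≤-Reasoning

blocks-∷-mono : ∀ x {u v} → u ⊆ v → blocks (x ∷ u) ≤ blocks (x ∷ v)
blocks-∷-mono x []                     = ≤-refl
blocks-∷-mono x (_∷ʳ_ {ys = v} y u⊆v) = ≤-trans (blocks-∷-mono x u⊆v) (blocks-insert x y v)
blocks-∷-mono x (_∷_ {y = y} refl u⊆v) = +-monoʳ-≤ (change x y) (blocks-∷-mono y u⊆v)

blocks-mono : ∀ {u v} → u ⊆ v → blocks u ≤ blocks v
blocks-mono []                     = ≤-refl
blocks-mono (_∷ʳ_ {ys = v} y u⊆v) = ≤-trans (blocks-mono u⊆v) (blocks-∷ʳ y v)
  where
  blocks-∷ʳ : ∀ y w → blocks w ≤ blocks (y ∷ w)
  blocks-∷ʳ y []      = z≤n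
  blocks-∷ʳ y (z ∷ w) = m≤n+m _ (change y z)
blocks-mono (_∷_ {x = x} refl u⊆v) = blocks-∷-mono x u⊆v

dropHead : ∀ {x xs y zs} → x ≤ y → All (y <_) zs → All (_∈ x ∷ xs) zs → All (_∈ xs) zs
dropHead x≤y []         []               = []
dropHead x≤y (y<z ∷ _)  (here refl ∷ _)  = ⊥-elim (<-irrefl refl (≤-<-trans x≤y y<z))
dropHead x≤y (_ ∷ y<zs) (there z∈ ∷ zs∈) = z∈ ∷ dropHead x≤y y<zs zs∈

increasing⊆sorted : ∀ {xs ys} → AllPairs _≤_ xs → AllPairs _<_ ys → All (_∈ xs) ys → ys ⊆ xs
increasing⊆sorted {[]}     {[]}     _ _ _ = []
increasing⊆sorted {[]}     {y ∷ ys} _ _ (() ∷ _)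
increasing⊆sorted {x ∷ xs} {[]}     (_ ∷ xs↗) _ _ = x ∷ʳ increasing⊆sorted xs↗ [] []
increasing⊆sorted {x ∷ xs} {y ∷ ys} (_ ∷ xs↗) (y<ys ∷ ys↗) (here refl ∷ ys∈) =
  refl ∷ increasing⊆sorted xs↗ ys↗ (dropHead ≤-refl y<ys ys∈)
increasing⊆sorted {x ∷ xs} {y ∷ ys} (x≤xs ∷ xs↗) ys↗@(y<ys ∷ _) (there y∈xs ∷ ys∈) =
  x ∷ʳ increasing⊆sorted xs↗ ys↗ (y∈xs ∷ dropHead (All.lookup x≤xs y∈xs) y<ys ys∈)

open InsertionSort ≤-decTotalOrder using (sort)
open InsertionSortProperties ≤-decTotalOrder using (sort-↗; sort-↭)

Witness : List ℕ → List ℕ → ℕ × Side → Set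
Witness L R (y , Lt) = y ∈ L
Witness L R (y , Rt) = y ∈ R × ¬ T (y ∈ᵇ L)

mixValue-≥ : ∀ L R (W : List (ℕ × Side)) → AllPairs (_<_ on proj₁) W → All (Witness L R) W →
             blocks (map proj₂ W) ≤ mixValue L R
mixValue-≥ L R W W↗ witnesses = subst (λ w → blocks w ≤ mixValue L R) (labels witnesses)
  (blocks-mono (⊆-map⁺ label (increasing⊆sorted (Linked⇒AllPairs ≤-trans (sort-↗ (L ++ R)))
                                                 (AllPairs.map⁺ W↗) (All.map⁺ (All.map member witnesses)))))
  where
  label : ℕ → Side
  label y = if y ∈ᵇ L then Lt else Rt
  member : ∀ {w} → Witness L R w → proj₁ w ∈ sort (L ++ R)
  member {_ , Lt} y∈L       = ∈-resp-↭ (↭-sym (sort-↭ (L ++ R))) (∈-++⁺ˡ y∈L)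
  member {_ , Rt} (y∈R , _) = ∈-resp-↭ (↭-sym (sort-↭ (L ++ R))) (∈-++⁺ʳ L y∈R)
  labels : ∀ {V} → All (Witness L R) V → map label (map proj₁ V) ≡ map proj₂ V
  labels [] = refl
  labels {(y , Lt) ∷ _} (y∈L ∷ ws) with y ∈ᵇ L | ∈⇒∈ᵇ y∈L
  ... | true | _ = cong (Lt ∷_) (labels ws)
  labels {(y , Rt) ∷ _} ((_ , y∉L) ∷ ws) with y ∈ᵇ L | y∉L
  ... | false | _  = cong (Rt ∷_) (labels ws)
  ... | true  | ¬t = ⊥-elim (¬t tt)

-- the point of position u (the y-coordinate is u + 1, as positions of G_X start at 1)
pt : (ℕ → ℕ) → ℕ → Point
pt g u = (g u , suc u)

graph : (ℕ → ℕ) → ℕ → List Point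
graph g m = applyUpTo (pt g) m

geom-applyUpTo : ∀ g m → geom (applyUpTo g m) ≡ graph g m
geom-applyUpTo g m = begin
    zip (applyUpTo g m) (map suc (upTo (length (applyUpTo g m))))
  ≡⟨ cong (λ l → zip (applyUpTo g m) (map suc (upTo l))) (length-applyUpTo g m) ⟩
    zip (applyUpTo g m) (map suc (upTo m))
  ≡⟨ cong (zip (applyUpTo g m)) (map-upTo suc m) ⟩
    zip (applyUpTo g m) (applyUpTo suc m)
  ≡⟨ zip-applyUpTo g suc m ⟩
    graph g m
  ∎
  where open ≡-Reasoning

Outside : ℕ → ℕ → ℕ → Set
Outside a b z = (z < a × z < b) ⊎ (a < z × b < z)

outside-range : ∀ {a b z} → Outside a b z → T (min a b ≤ᵇ z) → T (z ≤ᵇ max a b) → ⊥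
outside-range {a} {b} {z} out lo hi with a ≤ᵇ b
... | true  = contra out (≤ᵇ⇒≤ a z lo) (≤ᵇ⇒≤ z b hi)
  where
  contra : Outside a b z → a ≤ z → z ≤ b → ⊥
  contra (inj₁ (z<a , _)) a≤z _   = <-irrefl refl (<-≤-trans z<a a≤z)
  contra (inj₂ (_ , b<z)) _   z≤b = <-irrefl refl (<-≤-trans b<z z≤b)
... | false = contra out (≤ᵇ⇒≤ b z lo) (≤ᵇ⇒≤ z a hi)
  where
  contra : Outside a b z → b ≤ z → z ≤ a → ⊥
  contra (inj₁ (_ , z<b)) b≤z _   = <-irrefl refl (<-≤-trans z<b b≤z)
  contra (inj₂ (a<z , _)) _   z≤a = <-irrefl refl (<-≤-trans a<z z≤a)

inRect⇒inRange : ∀ p q r → T (inRect p q r) →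
  (T (min (px p) (px q) ≤ᵇ px r) × T (px r ≤ᵇ max (px p) (px q))) ×
  (T (min (py p) (py q) ≤ᵇ py r) × T (py r ≤ᵇ max (py p) (py q)))
inRect⇒inRange p q r inside
  with min (px p) (px q) ≤ᵇ px r | px r ≤ᵇ max (px p) (px q) | min (py p) (py q) ≤ᵇ py r | py r ≤ᵇ max (py p) (py q)
... | true  | true  | true  | true  = (tt , tt) , (tt , tt)
... | true  | true  | true  | false = ⊥-elim inside
... | true  | true  | false | _     = ⊥-elim inside
... | true  | false | _     | _     = ⊥-elim inside
... | false | _     | _     | _     = ⊥-elim inside

outside⇒∉rect : ∀ p q r → Outside (px p) (px q) (px r) ⊎ Outside (py p) (py q) (py r) → ¬ T (inRect p q r)
outside⇒∉rect p q r (inj₁ x-out) inside = let ((lo , hi) , _) = inRect⇒inRange p q r inside in outside-range x-out lo hi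
outside⇒∉rect p q r (inj₂ y-out) inside = let (_ , (lo , hi)) = inRect⇒inRange p q r inside in outside-range y-out lo hi

emptyRect-graph : ∀ g m s t → s < t → (∀ u → s < u → u < t → Outside (g t) (g s) (g u)) →
                  T (emptyRect (graph g m) (pt g t) (pt g s))
emptyRect-graph g m s t s<t between = all⁻ _ (All.applyUpTo⁺₂ (pt g) m allowed)
  where
  p q : Point
  p = pt g t
  q = pt g s
  notInside : ∀ r → ¬ T (inRect p q r) → T (not (inRect p q r) ∨ (r ==ᵖ p) ∨ (r ==ᵖ q))
  notInside r ∉ = T-∨ˡ (not (inRect p q r)) (T-not (inRect p q r) ∉)
  isP : T (not (inRect p q p) ∨ (p ==ᵖ p) ∨ (p ==ᵖ q))
  isP = T-∨ʳ (not (inRect p q p)) (T-∨ˡ (p ==ᵖ p) (==ᵖ-refl p))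
  isQ : T (not (inRect p q q) ∨ (q ==ᵖ p) ∨ (q ==ᵖ q))
  isQ = T-∨ʳ (not (inRect p q q)) (T-∨ʳ (q ==ᵖ p) (==ᵖ-refl q))
  allowed : ∀ u → T (not (inRect p q (pt g u)) ∨ (pt g u ==ᵖ p) ∨ (pt g u ==ᵖ q))
  allowed u with <-cmp u s
  ... | tri< u<s _ _ = notInside (pt g u) (outside⇒∉rect p q (pt g u) (inj₂ (inj₁ (s≤s (<-trans u<s s<t) , s≤s u<s))))
  ... | tri≈ _ refl _ = isQ
  ... | tri> _ _ s<u with <-cmp u t
  ...   | tri< u<t _ _ = notInside (pt g u) (outside⇒∉rect p q (pt g u) (inj₁ (between u s<u u<t)))
  ...   | tri≈ _ refl _ = isP
  ...   | tri> _ _ t<u = notInside (pt g u) (outside⇒∉rect p q (pt g u) (inj₂ (inj₂ (s≤s t<u , s≤s (<-trans s<t t<u)))))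

∈FL-graph : ∀ g m {s t} → s < t → t < m → g s < g t → T (emptyRect (graph g m) (pt g t) (pt g s)) →
            suc s ∈ ys (FL (graph g m) (pt g t))
∈FL-graph g m s<t t<m gs<gt empty = ∈-map⁺ py (∈-filter⁺ _ (∈-applyUpTo⁺ (pt g) (<-trans s<t t<m))
  (T-∧-intro (<⇒<ᵇ (s≤s s<t)) (T-∧-intro (<⇒<ᵇ gs<gt) empty)))

∈FR-graph : ∀ g m {s t} → s < t → t < m → g t < g s → T (emptyRect (graph g m) (pt g t) (pt g s)) →
            suc s ∈ ys (FR (graph g m) (pt g t))
∈FR-graph g m s<t t<m gt<gs empty = ∈-map⁺ py (∈-filter⁺ _ (∈-applyUpTo⁺ (pt g) (<-trans s<t t<m))
  (T-∧-intro (<⇒<ᵇ (s≤s s<t)) (T-∧-intro (<⇒<ᵇ gt<gs) empty)))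

∉FL-graph : ∀ g m {s t} → g t < g s → ¬ T (suc s ∈ᵇ ys (FL (graph g m) (pt g t)))
∉FL-graph g m {s} {t} gt<gs s∈ with ∈-map⁻ py (∈ᵇ⇒∈ {suc s} {ys (FL (graph g m) (pt g t))} s∈)
... | r , r∈FL , s≡ with ∈-filter⁻ _ {xs = graph g m} r∈FL
... | r∈G , cond with ∈-applyUpTo⁻ (pt g) r∈G
... | u , _ , refl with s≡
... | refl = <-asym gt<gs (<ᵇ⇒< (g s) (g t) (proj₁ (T-∧⇒ (g s <ᵇ g t) (proj₂ (T-∧⇒ (suc s <ᵇ suc t) cond)))))

Window : ℕ → (ℕ → ℕ) → ℕ → ℕ → Set
Window k g c t = ∀ u → u ≤ t → t < u + 2 ^ k → g u ≡ c + 2 ^ reversal k u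

window-< : ∀ {c x y a b} → a ≡ c + 2 ^ x → b ≡ c + 2 ^ y → x < y → a < b
window-< {c} gu gv x<y = subst₂ _<_ (sym gu) (sym gv) (+-monoʳ-< c (^-monoʳ-< 2 (s≤s (s≤s z≤n)) x<y))

window-outside : ∀ {c x y w a b z} → a ≡ c + 2 ^ x → b ≡ c + 2 ^ y → z ≡ c + 2 ^ w →
                 (w < x × w < y) ⊎ (x < w × y < w) → Outside a b z
window-outside ga gb gz (inj₁ (w<x , w<y)) = inj₁ (window-< gz ga w<x , window-< gz gb w<y)
window-outside ga gb gz (inj₂ (x<w , y<w)) = inj₂ (window-< ga gz x<w , window-< gb gz y<w)

module FunnelAtWindowEnd (k : ℕ) (g : ℕ → ℕ) (m c t : ℕ) (2^k≤t : 2 ^ k ≤ t) (t<m : t < m) (window : Window k g c t) where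

  G : List Point
  G = graph g m

  p : Point
  p = pt g t

  module Digit (a : ℕ) (a<k : a < k) where

    2^a<2^k : 2 ^ a < 2 ^ k
    2^a<2^k = ^-monoʳ-< 2 (s≤s (s≤s z≤n)) a<k

    s : ℕ
    s = t ∸ 2 ^ a

    s+2^a≡t : s + 2 ^ a ≡ t
    s+2^a≡t = m∸n+n≡m (≤-trans (<⇒≤ 2^a<2^k) 2^k≤t)

    s<t : s < t
    s<t = subst (s <_) s+2^a≡t (m<m+n s (m^n>0 2 a))

    inWindow : ∀ u → s ≤ u → u ≤ t → g u ≡ c + 2 ^ reversal k u
    inWindow u s≤u u≤t = window u u≤t (begin-strict
      t          ≡⟨ sym s+2^a≡t ⟩
      s + 2 ^ a  <⟨ +-mono-≤-< s≤u 2^a<2^k ⟩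
      u + 2 ^ k  ∎)
      where open ≤-Reasoning

    g-t : g t ≡ c + 2 ^ reversal k t
    g-t = inWindow t (<⇒≤ s<t) ≤-refl

    g-s : g s ≡ c + 2 ^ reversal k s
    g-s = inWindow s ≤-refl (<⇒≤ s<t)

    agree : AgreeBelow a t s
    agree = subst (λ z → AgreeBelow a z s) s+2^a≡t (agree-+2^ a s)

    differ : bit a t ≢ bit a s
    differ = subst (λ z → bit a z ≢ bit a s) s+2^a≡t (bit-+2^ a s)

    disagreeBetween : ∀ u → s < u → u < t → ¬ AgreeBelow a u t
    disagreeBetween u s<u u<t ag = ¬agree-+ a u (t ∸ u) (m<n⇒0<n∸m u<t) d<2^a
      (subst (λ z → AgreeBelow a z u) (sym u+d≡t) (agree-sym a ag))
      where
      u+d≡t : u + (t ∸ u) ≡ t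
      u+d≡t = m+[n∸m]≡n (<⇒≤ u<t)
      d<2^a : t ∸ u < 2 ^ a
      d<2^a = +-cancelˡ-< u (t ∸ u) (2 ^ a) (subst (_< u + 2 ^ a) (sym u+d≡t)
                (subst (_< u + 2 ^ a) s+2^a≡t (+-monoˡ-< (2 ^ a) s<u)))

    empty : T (emptyRect G p (pt g s))
    empty = emptyRect-graph g m s t s<t outside
      where
      outside : ∀ u → s < u → u < t → Outside (g t) (g s) (g u)
      outside u s<u u<t = window-outside g-t g-s (inWindow u (<⇒≤ s<u) (<⇒≤ u<t))
        (reversal-sameSide k a u t s a<k (disagreeBetween u s<u u<t) agree)

    leftWitness : bit a t ≡ 1 → suc s ∈ ys (FL G p)
    leftWitness t1 = ∈FL-graph g m s<t t<m (window-< g-s g-t (reversal-< k a s t a<k (agree-sym a agree) s0 t1)) empty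
      where
      s0 : bit a s ≡ 0
      s0 = bit≢1 a s (λ s1 → differ (trans t1 (sym s1)))

    rightWitness : bit a t ≡ 0 → suc s ∈ ys (FR G p) × ¬ T (suc s ∈ᵇ ys (FL G p))
    rightWitness t0 = ∈FR-graph g m s<t t<m gt<gs empty , ∉FL-graph g m gt<gs
      where
      s1 : bit a s ≡ 1
      s1 = bit≢0 a s (λ s0 → differ (trans t0 (sym s0)))
      gt<gs : g t < g s
      gt<gs = window-< g-t g-s (reversal-< k a t s a<k agree t0 s1)

  witness : ℕ → ℕ × Side
  witness a = suc (t ∸ 2 ^ a) , side (bit a t)

  isWitness : ∀ a → a < k → Witness (ys (FL G p)) (ys (FR G p)) (witness a)
  isWitness a a<k with bit a t in eq | bit-01 a t
  ... | zero        | _ = Digit.rightWitness a a<k eq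
  ... | suc zero    | _ = Digit.leftWitness a a<k eq
  ... | suc (suc _) | inj₁ ()
  ... | suc (suc _) | inj₂ ()

  -- larger digits give earlier positions, so listing digits downwards lists witnesses upwards
  witnesses↗ : AllPairs (_<_ on proj₁) (applyDownFrom witness k)
  witnesses↗ = AllPairs.applyDownFrom⁺₁ witness k (λ {i} {j} j<i i<k →
    s≤s (∸-monoʳ-< (^-monoʳ-< 2 (s≤s (s≤s z≤n)) j<i) (≤-trans (<⇒≤ (^-monoʳ-< 2 (s≤s (s≤s z≤n)) i<k)) 2^k≤t)))

  -- the labels of the witnesses spell the digit word of t
  runs≤f : runs k t ≤ f G p
  runs≤f = subst (λ w → blocks w ≤ f G p) (map-applyDownFrom witness proj₂ k)
    (mixValue-≥ (ys (FL G p)) (ys (FR G p)) (applyDownFrom witness k) witnesses↗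
                (All.applyDownFrom⁺₁ witness k (λ {a} → isWitness a)))

runs≤funnelValue : ∀ k g m c t → 2 ^ k ≤ t → t < m → Window k g c t → runs k t ≤ f (graph g m) (pt g t)
runs≤funnelValue k g m c t 2^k≤t t<m window = FunnelAtWindowEnd.runs≤f k g m c t 2^k≤t t<m window

blockIndex : ∀ i N v .{{_ : NonZero N}} → v < N → (i * N + v) / N ≡ i
blockIndex i N v v<N = begin
    (i * N + v) / N    ≡⟨ cong (_/ N) (+-comm (i * N) v) ⟩
    (v + i * N) / N    ≡⟨ +-distrib-/-∣ʳ v (divides i refl) ⟩
    v / N + i * N / N  ≡⟨ cong₂ _+_ (m<n⇒m/n≡0 v<N) (m*n/n≡m i N) ⟩
    i                  ∎
  where open ≡-Reasoning

blockLength : ℕ → ℕ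
blockLength k = 2 ^ 2 ^ k * 2 ^ k

blockLength≢0 : ∀ k → NonZero (blockLength k)
blockLength≢0 k = m*n≢0 (2 ^ 2 ^ k) (2 ^ k) {{m^n≢0 2 (2 ^ k)}} {{m^n≢0 2 k}}

-- the entry of X̃ at position t (counted from 0): it lies in a copy of S_(t / nK),
-- at index t mod 2^k of that copy
xtilde : ℕ → ℕ → ℕ
xtilde k t = _/_ t (blockLength k) {{blockLength≢0 k}} + 2 ^ reversal k t

xtilde-inBlock : ∀ k i u → i * blockLength k ≤ u → u < i * blockLength k + blockLength k →
                 xtilde k u ≡ i + 2 ^ reversal k u
xtilde-inBlock k i u lo hi = cong (_+ 2 ^ reversal k u) (begin
    u / N                        ≡⟨ cong (_/ N) (sym (m+[n∸m]≡n lo)) ⟩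
    (i * N + (u ∸ i * N)) / N    ≡⟨ blockIndex i N (u ∸ i * N) offset< ⟩
    i                            ∎)
  where
  open ≡-Reasoning
  N : ℕ
  N = blockLength k
  instance
    N≢0 : NonZero N
    N≢0 = blockLength≢0 k
  offset< : u ∸ i * N < N
  offset< = subst (u ∸ i * N <_) (m+n∸n≡m N (i * N)) (∸-monoˡ-< (subst (u <_) (+-comm (i * N) N) hi) lo)

S≡applyUpTo : ∀ k i → S k i ≡ applyUpTo (λ j → i + 2 ^ reversal k j) (2 ^ k)
S≡applyUpTo k i = begin
    map (λ b → i + 2 ^ b) (map (λ j → readBinary (reverse (binary k j))) (upTo (2 ^ k)))
  ≡⟨ sym (map-∘ (upTo (2 ^ k))) ⟩
    map (λ j → i + 2 ^ readBinary (reverse (binary k j))) (upTo (2 ^ k))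
  ≡⟨ map-upTo _ (2 ^ k) ⟩
    applyUpTo (λ j → i + 2 ^ readBinary (reverse (binary k j))) (2 ^ k)
  ≡⟨ applyUpTo-cong (2 ^ k) (λ j _ → cong (λ r → i + 2 ^ r) (readBinary-reverse-binary k j)) ⟩
    applyUpTo (λ j → i + 2 ^ reversal k j) (2 ^ k)
  ∎
  where open ≡-Reasoning

nCopies≡ : ∀ k i → concat (replicate (2 ^ 2 ^ k) (S k i)) ≡ applyUpTo (λ v → xtilde k (i * blockLength k + v)) (blockLength k)
nCopies≡ k i = begin
    concat (replicate n (S k i))
  ≡⟨ cong concat (replicate-applyUpTo n (S k i)) ⟩
    concat (applyUpTo (λ _ → S k i) n)
  ≡⟨ cong concat (applyUpTo-cong n (λ c _ → trans (S≡applyUpTo k i) (applyUpTo-cong K (λ j _ → copy c j)))) ⟩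
    concat (applyUpTo (λ c → applyUpTo (λ j → F (c * K + j)) K) n)
  ≡⟨ concat-applyUpTo F K n ⟩
    applyUpTo F N
  ≡⟨ applyUpTo-cong N (λ v v<N → sym (entry v v<N)) ⟩
    applyUpTo (λ v → xtilde k (i * N + v)) N
  ∎
  where
  open ≡-Reasoning
  K n N : ℕ
  K = 2 ^ k
  n = 2 ^ K
  N = blockLength k
  F : ℕ → ℕ
  F v = i + 2 ^ reversal k v
  periodic : ∀ c v → reversal k (c * K + v) ≡ reversal k v
  periodic c v = trans (cong (reversal k) (+-comm (c * K) v)) (reversal-+multiple k v c)
  copy : ∀ c j → i + 2 ^ reversal k j ≡ F (c * K + j)
  copy c j = cong (λ r → i + 2 ^ r) (sym (periodic c j))
  entry : ∀ v → v < N → xtilde k (i * N + v) ≡ F v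
  entry v v<N = trans (xtilde-inBlock k i (i * N + v) (m≤m+n (i * N) v) (+-monoʳ-< (i * N) v<N))
                      (cong (λ r → i + 2 ^ r) (trans (cong (λ z → reversal k (z + v)) (sym (*-assoc i n K)))
                                                     (periodic (i * n) v)))

Xtilde≡applyUpTo : ∀ k → Xtilde k ≡ applyUpTo (xtilde k) ((2 ^ 2 ^ k / 2 + 1) * blockLength k)
Xtilde≡applyUpTo k = begin
    concat (map (λ i → concat (replicate (2 ^ 2 ^ k) (S k i))) (upTo B))
  ≡⟨ cong concat (map-upTo _ B) ⟩
    concat (applyUpTo (λ i → concat (replicate (2 ^ 2 ^ k) (S k i))) B)
  ≡⟨ cong concat (applyUpTo-cong B (λ i _ → nCopies≡ k i)) ⟩
    concat (applyUpTo (λ i → applyUpTo (λ v → xtilde k (i * blockLength k + v)) (blockLength k)) B)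
  ≡⟨ concat-applyUpTo (xtilde k) (blockLength k) B ⟩
    applyUpTo (xtilde k) (B * blockLength k)
  ∎
  where
  open ≡-Reasoning
  B : ℕ
  B = 2 ^ 2 ^ k / 2 + 1

Funnel-Xtilde : ∀ k → let M = (2 ^ 2 ^ k / 2 + 1) * blockLength k in
  Funnel (Xtilde k) ≡ sumBelow M (λ t → f (graph (xtilde k) M) (pt (xtilde k) t))
Funnel-Xtilde k = begin
    sum (map (f (geom (Xtilde k))) (geom (Xtilde k)))
  ≡⟨ cong (λ P → sum (map (f P) P)) (trans (cong geom (Xtilde≡applyUpTo k)) (geom-applyUpTo (xtilde k) M)) ⟩
    sum (map (f (graph (xtilde k) M)) (applyUpTo (pt (xtilde k)) M))
  ≡⟨ cong sum (map-applyUpTo (pt (xtilde k)) _ M) ⟩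
    sumBelow M (λ t → f (graph (xtilde k) M) (pt (xtilde k) t))
  ∎
  where
  open ≡-Reasoning
  M : ℕ
  M = (2 ^ 2 ^ k / 2 + 1) * blockLength k

-- Summing the local estimate over X̃. Positions of block i outside its first copy of S_i end a
-- window of length K inside block i, so the local estimate applies to all but one copy per block.

module CountingXtilde (k : ℕ) where

  K n B N M : ℕ
  K = 2 ^ k
  n = 2 ^ K
  B = n / 2 + 1
  N = blockLength k
  M = B * N

  φ : ℕ → ℕ
  φ t = f (graph (xtilde k) M) (pt (xtilde k) t)

  suc[n∸1]≡n : suc (n ∸ 1) ≡ n
  suc[n∸1]≡n = m+[n∸m]≡n (m^n>0 2 K)

  runs≤φ : ∀ i c j → i < B → c < n ∸ 1 → j < K → runs k j ≤ φ (i * N + (K + (c * K + j)))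
  runs≤φ i c j i<B c<n-1 j<K = subst (_≤ φ t) (runs-cong k t j sameDigits)
    (runs≤funnelValue k (xtilde k) M i t K≤t t<M window)
    where
    open ≤-Reasoning
    w t : ℕ
    w = K + (c * K + j)
    t = i * N + w
    w<N : w < N
    w<N = begin-strict
      K + (c * K + j)   <⟨ +-monoʳ-< K (+-monoʳ-< (c * K) j<K) ⟩
      K + (c * K + K)   ≡⟨ cong (K +_) (+-comm (c * K) K) ⟩
      suc (suc c) * K   ≤⟨ *-monoˡ-≤ K (subst (suc (suc c) ≤_) suc[n∸1]≡n (s≤s c<n-1)) ⟩
      n * K             ∎
    K≤t : K ≤ t
    K≤t = ≤-trans (m≤m+n K (c * K + j)) (m≤n+m w (i * N))
    t<M : t < M
    t<M = begin-strict
      i * N + w  <⟨ +-monoʳ-< (i * N) w<N ⟩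
      i * N + N  ≡⟨ +-comm (i * N) N ⟩
      suc i * N  ≤⟨ *-monoˡ-≤ N i<B ⟩
      B * N      ∎
    window : Window k (xtilde k) i t
    window u u≤t t<u+K = xtilde-inBlock k i u blockStart (≤-<-trans u≤t (+-monoʳ-< (i * N) w<N))
      where
      blockStart : i * N ≤ u
      blockStart = +-cancelʳ-≤ K (i * N) u (≤-trans (+-monoʳ-≤ (i * N) (m≤m+n K (c * K + j))) (<⇒≤ t<u+K))
    t≡ : t ≡ j + (i * n + suc c) * K
    t≡ = rearrange i n K c j
      where
      rearrange : ∀ i n K c j → i * (n * K) + (K + (c * K + j)) ≡ j + (i * n + suc c) * K
      rearrange = solve-∀
    sameDigits : ∀ a → a < k → bit a t ≡ bit a j
    sameDigits a a<k = trans (cong (bit a) t≡) (bit-+multiple a k j (i * n + suc c) a<k)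

  funnel-≥ : B * ((n ∸ 1) * sumBelow K (runs k)) ≤ Funnel (Xtilde k)
  funnel-≥ = subst (B * ((n ∸ 1) * sumBelow K (runs k)) ≤_) (sym (Funnel-Xtilde k))
    (sumBelow-blocks B N _ φ perBlock)
    where
    open ≤-Reasoning
    perBlock : ∀ i → i < B → (n ∸ 1) * sumBelow K (runs k) ≤ sumBelow N (λ v → φ (i * N + v))
    perBlock i i<B = begin
        (n ∸ 1) * sumBelow K (runs k)
      ≤⟨ sumBelow-blocks (n ∸ 1) K _ (λ v → φ (i * N + (K + v))) (λ c c<n-1 →
           sumBelow-mono K (λ j j<K → runs≤φ i c j i<B c<n-1 j<K)) ⟩
        sumBelow ((n ∸ 1) * K) (λ v → φ (i * N + (K + v)))
      ≤⟨ m≤n+m _ _ ⟩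
        sumBelow K (λ v → φ (i * N + v)) + sumBelow ((n ∸ 1) * K) (λ v → φ (i * N + (K + v)))
      ≡⟨ sym (sumBelow-split K ((n ∸ 1) * K) (λ v → φ (i * N + v))) ⟩
        sumBelow (suc (n ∸ 1) * K) (λ v → φ (i * N + v))
      ≡⟨ cong (λ z → sumBelow (z * K) (λ v → φ (i * N + v))) suc[n∸1]≡n ⟩
        sumBelow N (λ v → φ (i * N + v))
      ∎

quarter-count : ∀ B n k P → 2 ≤ n → B * n * (2 * P) * suc k ≤ 4 * (B * ((n ∸ 1) * ((2 + k) * P)))
quarter-count B (suc (suc n)) k P (s≤s (s≤s z≤n)) = begin
    B * (2 + n) * (2 * P) * suc k
  ≤⟨ m≤m+n _ _ ⟩
    B * (2 + n) * (2 * P) * suc k + 2 * B * P * (2 + 3 * n + n * k)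
  ≡⟨ expand B n k P ⟩
    4 * (B * ((1 + n) * ((2 + k) * P)))
  ∎
  where
  open ≤-Reasoning
  expand : ∀ B n k P → B * (2 + n) * (2 * P) * suc k + 2 * B * P * (2 + 3 * n + n * k) ≡ 4 * (B * ((1 + n) * ((2 + k) * P)))
  expand = solve-∀

lg-lg-2^2^ : ∀ k → lg (lg (2 ^ 2 ^ k)) ≡ k
lg-lg-2^2^ k = trans (cong lg (⌊log₂[2^n]⌋≡n (2 ^ k))) (⌊log₂[2^n]⌋≡n k)

¼ : ℚ
¼ = ℤ.+ 1 ℚ./ 4

0<¼ : 0ℚ <ℚ ¼
0<¼ = ℚ.*<* (ℤ.+<+ (s≤s z≤n))

toℚ≡mkℚ : ∀ x → toℚ x ≡ ℚ.mkℚ (ℤ.+ x) 0 (coprime-sym (1-coprimeTo x))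
toℚ≡mkℚ x = ℚ.normalize-coprime (coprime-sym (1-coprimeTo x))

quarter-≤ : ∀ x y → x ≤ 4 * y → ¼ *ℚ toℚ x ≤ℚ toℚ y
quarter-≤ x y x≤4y =
  ℚ.toℚᵘ-cancel-≤ (ℚᵘ.≤-respˡ-≃ (ℚᵘ.≃-sym (ℚ.toℚᵘ-homo-* ¼ (toℚ x))) unnormalised)
  where
  unnormalised : ℚ.toℚᵘ ¼ ℚᵘ.* ℚ.toℚᵘ (toℚ x) ℚᵘ.≤ ℚ.toℚᵘ (toℚ y)
  unnormalised rewrite toℚ≡mkℚ x | toℚ≡mkℚ y = ℚᵘ.*≤* (subst₂ ℤ._≤_ (sym lhs) (sym rhs) (ℤ.+≤+ x≤4y))
    where
    lhs : (Sign.+ ℤ.◃ (x + 0)) ℤ.* ℤ.+ 1 ≡ ℤ.+ x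
    lhs = trans (ℤ.*-identityʳ _) (trans (ℤ.+◃n≡+n _) (cong ℤ.+_ (+-identityʳ x)))
    rhs : ℤ.+ y ℤ.* ℤ.+ 4 ≡ ℤ.+ (4 * y)
    rhs = trans (sym (ℤ.pos-* y 4)) (cong ℤ.+_ (*-comm y 4))

lemma27 : Σ ℚ (λ c → (0ℚ <ℚ c) × ((k : ℕ) → k ≥ 1 →
    let K = 2 ^ k
        n = 2 ^ K
        m = (n / 2 + 1) * n * K
    in c *ℚ toℚ (m * lg (lg n)) ≤ℚ toℚ (Funnel (Xtilde k))))
lemma27 = ¼ , 0<¼ , bound
  where
  bound : (k : ℕ) → k ≥ 1 →
    let K = 2 ^ k
        n = 2 ^ K
        m = (n / 2 + 1) * n * K
    in ¼ *ℚ toℚ (m * lg (lg n)) ≤ℚ toℚ (Funnel (Xtilde k))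
  bound (suc k) _ = quarter-≤ (B * n * K * lg (lg n)) (Funnel (Xtilde (suc k))) (begin
      B * n * K * lg (lg n)                              ≡⟨ cong (B * n * K *_) (lg-lg-2^2^ (suc k)) ⟩
      B * n * K * suc k                                  ≤⟨ quarter-count B n k (2 ^ k) 2≤n ⟩
      4 * (B * ((n ∸ 1) * ((2 + k) * 2 ^ k)))            ≡⟨ cong (λ S → 4 * (B * ((n ∸ 1) * S))) (sym (sumBelow-runs k)) ⟩
      4 * (B * ((n ∸ 1) * sumBelow K (runs (suc k))))    ≤⟨ *-monoʳ-≤ 4 (CountingXtilde.funnel-≥ (suc k)) ⟩
      4 * Funnel (Xtilde (suc k))                        ∎)
    where
    open ≤-Reasoning
    K n B : ℕ
    K = 2 ^ suc k
    n = 2 ^ K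
    B = n / 2 + 1
    2≤n : 2 ≤ n
    2≤n = ^-monoʳ-≤ 2 {1} {K} (m^n>0 2 (suc k))
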